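{- Let $m \geq 1$ and $k \geq 2$ be integers, let $w$ be an $m$-weighting of a graph $G$, and let $A = \{a_1,\ldots,a_r\}$ and $B = \{b_1,\ldots,b_r\}$ be disjoint $r$-element subsets of $V(G)$ such that (1) $a_i b_i \in E(G)$ for each $i \in [r]$; (2) $B$ is an independent set of $G$; and (3) $N_G(b_i) \setminus \left(A \cup \{v \in V(G) : w(v) = 0\}\right) \subseteq N_G(a_i)$ for each $i \in [r]$. Let $w'$ be the $m$-weighting of $G$ defined by $w'(v) = 0$ if $v \in A$, $w'(b_i) = w(b_i) + w(a_i)$ for each $i \in [r]$, and $w'(v) = w(v)$ for all other $v \in V(G)$. Then $\pi_k(G(w')) \leq \pi_k(G(w))$.
   Context: All graphs are simple. $\mathbb{N}_0 = \{0,1,2,\dots\}$, $[r] = \{1,\dots,r\}$. $N_G(v)$ denotes the set of neighbours of $v$ in $G$. For a graph $G$, a function $w: V(G) \to \mathbb{N}_0$ with $\sum_{v \in V(G)} w(v) = m$ is an $m$-weighting of $G$. $G(w)$ is the graph obtained from $G$ by replacing each vertex $v$ by a clique $K^v$ on $w(v)$ vertices and joining every vertex of $K^u$ to every vertex of $K^v$ whenever $uv \in E(G)$. $\pi_k(H)$ denotes the number of $k$-cliques of a graph $H$. -}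

module Defs where

open import Data.Nat using (ℕ; zero; suc; _+_)
open import Data.Bool using (Bool; true; false; _∧_; _∨_; not; if_then_else_)
open import Data.Fin using (Fin)
open import Data.Fin.Properties using (_≟_)
open import Data.Fin.Subset using (Subset; _∈_; ∣_∣)
open import Data.Vec using (Vec; []; _∷_)
open import Data.List using (List; []; _∷_; length; map; concatMap; allFin; upTo; filter; _++_; lookup)
open import Data.Nat.ListAction using (sum)
open import Data.Product using (_×_; _,_; proj₁; proj₂)
open import Data.Maybe using (Maybe; just; nothing)
open import Relation.Nullary using (does; yes; no)
open import Relation.Binary.PropositionalEquality using (_≡_; refl; sym; cong₂)
open import Data.Bool.Properties using (∨-comm; ∧-comm)

record Graph (n : ℕ) : Set where
  field
    adj   : Fin n → Fin n → Bool
    symm  : ∀ u v → adj u v ≡ adj v u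
    irref : ∀ v → adj v v ≡ false
open Graph public

_=ᶠ_ : ∀ {n} → Fin n → Fin n → Bool
i =ᶠ j = does (i ≟ j)

=ᶠ-sym : ∀ {n} (i j : Fin n) → (i =ᶠ j) ≡ (j =ᶠ i)
=ᶠ-sym i j with i ≟ j | j ≟ i
... | yes _ | yes _ = refl
... | no _  | no _  = refl
... | yes p | no q  with q (sym p)
... | ()
=ᶠ-sym i j | no q | yes p with q (sym p)
... | ()

=ᶠ-refl : ∀ {n} (i : Fin n) → (i =ᶠ i) ≡ true
=ᶠ-refl i with i ≟ i
... | yes _ = refl
... | no q with q refl
... | ()

wsum : ∀ {n} → (Fin n → ℕ) → ℕ
wsum {n} w = sum (map w (allFin n))

-- vertices of the blow-up G(w): pairs (v , j) with j < w v (j indexes the clique K^v)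
blowVerts : ∀ {n} → (Fin n → ℕ) → List (Fin n × ℕ)
blowVerts {n} w = concatMap (λ v → map (λ j → (v , j)) (upTo (w v))) (allFin n)

-- The blow-up G(w): each vertex v replaced by a clique K^v of size w v, and
-- K^u, K^v completely joined when uv ∈ E(G).
blowup : ∀ {n} → Graph n → (w : Fin n → ℕ) → Graph (length (blowVerts w))
blowup {n} G w = record { adj = a ; symm = s ; irref = ir }
  where
    L = blowVerts w
    a : Fin (length L) → Fin (length L) → Bool
    a x y = not (x =ᶠ y) ∧ ((proj₁ (lookup L x) =ᶠ proj₁ (lookup L y)) ∨ adj G (proj₁ (lookup L x)) (proj₁ (lookup L y)))
    s : ∀ x y → a x y ≡ a y x
    s x y = cong₂ (λ p q → not p ∧ q) (=ᶠ-sym x y)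
              (cong₂ _∨_ (=ᶠ-sym (proj₁ (lookup L x)) (proj₁ (lookup L y)))
                         (symm G (proj₁ (lookup L x)) (proj₁ (lookup L y))))
    ir : ∀ x → a x x ≡ false
    ir x rewrite =ᶠ-refl x = refl

subsets : (N : ℕ) → List (Subset N)
subsets zero    = [] ∷ []
subsets (suc N) = map (false ∷_) (subsets N) ++ map (true ∷_) (subsets N)

memb : ∀ {N} → Fin N → Subset N → Bool
memb i s = Data.Vec.lookup s i

allB : ∀ {A : Set} → (A → Bool) → List A → Bool
allB p [] = true
allB p (x ∷ xs) = p x ∧ allB p xs

isClique : ∀ {N} → Graph N → Subset N → Bool
isClique {N} H s =
  allB (λ i → allB (λ j → not (memb i s ∧ memb j s ∧ not (i =ᶠ j)) ∨ adj H i j) (allFin N)) (allFin N)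

π : ℕ → ∀ {N} → Graph N → ℕ
π k {N} H = length (filter (λ s → (∣ s ∣ ≟ₙ k)) (filter (λ s → isClique H s ≟ᵇ true) (subsets N)))
  where
    open import Data.Nat.Properties renaming (_≟_ to _≟ₙ_)
    open import Data.Bool.Properties renaming (_≟_ to _≟ᵇ_)

findIdx : ∀ {r n} → (Fin r → Fin n) → Fin n → Maybe (Fin r)
findIdx {zero}  f v = nothing
findIdx {suc r} f v with f Fin.zero ≟ v
... | yes _ = just Fin.zero
... | no _  with findIdx (λ i → f (Fin.suc i)) v
...   | just i  = just (Fin.suc i)
...   | nothing = nothing

shift : ∀ {r n} → (a b : Fin r → Fin n) → (Fin n → ℕ) → Fin n → ℕ
shift a b w v with findIdx a v
... | just _  = 0
... | nothing with findIdx b v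
...   | just i  = w (b i) + w (a i)
...   | nothing = w v

-- G(w') admits an injective graph homomorphism into G(w), and such a homomorphism maps k-cliques
-- injectively to k-cliques.  The clique K^{b_i} of G(w') has w(b_i) + w(a_i) vertices: send the
-- first w(a_i) of them to K^{a_i} and the rest to K^{b_i}, and fix all other vertices (K^v is
-- empty in G(w') for v ∈ A).  The image of K^{b_i} lies in K^{a_i} ∪ K^{b_i}, a clique since
-- a_i b_i ∈ E(G); the blocks K^{b_i}, K^{b_j} are not joined since B is independent; and if
-- K^{b_i} is joined to a non-empty K^v with v ∉ A ∪ B, then b_i v ∈ E(G) and w(v) ≠ 0, so
-- a_i v ∈ E(G) by (3).
module Submission where

open import Defs
open import Data.Nat using (ℕ; zero; suc; _+_; _∸_; _≤_; _<_; _≥_)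
open import Data.Nat.Properties
  using (≮⇒≥; _<?_; n≮0; m<n⇒n≢0; m∸n+n≡m; m+n∸n≡m; ∸-monoˡ-<)
  renaming (_≟_ to _≟ℕ_)
open import Data.Bool using (Bool; true; false; _∧_; _∨_; not)
open import Data.Bool.Properties using () renaming (_≟_ to _≟𝔹_)
open import Data.Fin using (Fin; zero; suc)
open import Data.Fin.Properties using (_≟_; pigeonhole; <⇒≢; 0≢1+n; suc-injective)
open import Data.Fin.Subset
  using (Subset; inside; outside; ⁅_⁆; _∪_; _⊆_; ∣_∣)
  renaming (_∈_ to _∈ₛ_; _∉_ to _∉ₛ_; ⊥ to ∅)
open import Data.Fin.Subset.Properties
  using (∉⊥; x∈⁅x⁆; x∈⁅y⁆⇒x≡y; x∈p∪q⁺; x∈p∪q⁻; ⊆-antisym; ∪-identityˡ; ∣⊥∣≡0)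
open import Data.Vec using ([]; _∷_; here; there)
open import Data.Vec.Properties using ([]=⇒lookup; lookup⇒[]=)
open import Data.List using (List; []; _∷_; length; map; filter; allFin; upTo; lookup)
open import Data.List.Membership.Propositional using (_∈_)
open import Data.List.Membership.Propositional.Properties
  using (∈-lookup; ∈-allFin; ∈-upTo⁺; ∈-upTo⁻; ∈-map⁺; ∈-map⁻; ∈-filter⁺; ∈-filter⁻;
         ∈-++⁺ˡ; ∈-++⁺ʳ; ∈-concat⁺′; ∈-concat⁻′)
import Data.List.Relation.Unary.All as All
open import Data.List.Relation.Unary.AllPairs using ([]; _∷_)
import Data.List.Relation.Unary.AllPairs as AllPairs
import Data.List.Relation.Unary.AllPairs.Properties as AllPairs
open import Data.List.Relation.Unary.Any as Any using ()
open import Data.List.Relation.Unary.Any.Properties using (lookup-index)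
open import Data.List.Relation.Unary.Unique.Propositional using (Unique)
import Data.List.Relation.Unary.Unique.Propositional.Properties as Unique
open import Data.Maybe using (just; nothing)
open import Data.Product using (_×_; _,_; proj₁; proj₂; ∃-syntax)
open import Data.Product.Properties using (,-injective)
open import Data.Sum using (_⊎_; inj₁; inj₂)
open import Data.Empty using (⊥; ⊥-elim)
open import Function using (_∘_; _∋_)
open import Function.Definitions using (Injective)
open import Relation.Nullary using (¬_; yes; no; contradiction)
open import Relation.Nullary.Decidable using (dec-false)
open import Relation.Binary.PropositionalEquality
  using (_≡_; _≢_; refl; sym; trans; cong; subst; subst₂; module ≡-Reasoning)

index-injective : ∀ {A : Set} {xs : List A} {x y} (p : x ∈ xs) (q : y ∈ xs) → Any.index p ≡ Any.index q → x ≡ y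
index-injective {xs = xs} p q eq = trans (lookup-index p) (trans (cong (lookup xs) eq) (sym (lookup-index q)))

module _ {A : Set} where

  lookup-injective : ∀ {xs : List A} → Unique xs → Injective _≡_ _≡_ (lookup xs)
  lookup-injective {_ ∷ _} _             {zero}  {zero}  _  = refl
  lookup-injective         (x∉xs ∷ _)    {zero}  {suc j} eq = ⊥-elim (All.lookup x∉xs (∈-lookup j) eq)
  lookup-injective         (x∉xs ∷ _)    {suc i} {zero}  eq = ⊥-elim (All.lookup x∉xs (∈-lookup i) (sym eq))
  lookup-injective         (_    ∷ xs!)  {suc i} {suc j} eq = cong suc (lookup-injective xs! eq)

  length-≤-injection : ∀ {B : Set} {xs : List A} {ys : List B} {f : A → B} → Unique xs
    → Injective _≡_ _≡_ f → (∀ {x} → x ∈ xs → f x ∈ ys) → length xs ≤ length ys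
  length-≤-injection {xs = xs} {ys} xs! f-inj into = ≮⇒≥ λ ys<xs →
    let i , j , i<j , gi≡gj = pigeonhole ys<xs slot
    in <⇒≢ i<j (lookup-injective xs! (f-inj (index-injective (into (∈-lookup i)) (into (∈-lookup j)) gi≡gj)))
    where
    slot : Fin (length xs) → Fin (length ys)
    slot i = Any.index (into (∈-lookup i))

image : ∀ {n m} → (Fin n → Fin m) → Subset n → Subset m
image φ []            = ∅
image φ (outside ∷ s) = image (φ ∘ suc) s
image φ (inside  ∷ s) = ⁅ φ zero ⁆ ∪ image (φ ∘ suc) s

∈-image⁺ : ∀ {n m} (φ : Fin n → Fin m) {x s} → x ∈ₛ s → φ x ∈ₛ image φ s
∈-image⁺ φ {zero}  {inside  ∷ s} here         = x∈p∪q⁺ (inj₁ (x∈⁅x⁆ (φ zero)))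
∈-image⁺ φ {suc x} {outside ∷ s} (there x∈s) = ∈-image⁺ (φ ∘ suc) x∈s
∈-image⁺ φ {suc x} {inside  ∷ s} (there x∈s) = x∈p∪q⁺ (inj₂ (∈-image⁺ (φ ∘ suc) x∈s))

∈-image⁻ : ∀ {n m} (φ : Fin n → Fin m) s {y} → y ∈ₛ image φ s → ∃[ x ] x ∈ₛ s × φ x ≡ y
∈-image⁻ φ [] y∈ = ⊥-elim (∉⊥ y∈)
∈-image⁻ φ (outside ∷ s) y∈ with ∈-image⁻ (φ ∘ suc) s y∈
... | x , x∈s , φx≡y = suc x , there x∈s , φx≡y
∈-image⁻ φ (inside ∷ s) y∈ with x∈p∪q⁻ ⁅ φ zero ⁆ (image (φ ∘ suc) s) y∈
... | inj₁ y∈⁅φ0⁆ = zero , here , sym (x∈⁅y⁆⇒x≡y (φ zero) y∈⁅φ0⁆)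
... | inj₂ y∈′ with ∈-image⁻ (φ ∘ suc) s y∈′
...   | x , x∈s , φx≡y = suc x , there x∈s , φx≡y

image-injective : ∀ {n m} {φ : Fin n → Fin m} → Injective _≡_ _≡_ φ → Injective _≡_ _≡_ (image φ)
image-injective {φ = φ} φ-inj {s} {t} eq = ⊆-antisym (image-reflects-⊆ s t eq) (image-reflects-⊆ t s (sym eq))
  where
  image-reflects-⊆ : ∀ s t → image φ s ≡ image φ t → s ⊆ t
  image-reflects-⊆ s t eq x∈s with ∈-image⁻ φ t (subst (_ ∈ₛ_) eq (∈-image⁺ φ x∈s))
  ... | x′ , x′∈t , φx′≡φx = subst (_∈ₛ t) (φ-inj φx′≡φx) x′∈t

∣⁅x⁆∪p∣≡1+∣p∣ : ∀ {n} (x : Fin n) (p : Subset n) → x ∉ₛ p → ∣ ⁅ x ⁆ ∪ p ∣ ≡ suc ∣ p ∣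
∣⁅x⁆∪p∣≡1+∣p∣ zero    (outside ∷ p) _   = cong (suc ∘ ∣_∣) (∪-identityˡ p)
∣⁅x⁆∪p∣≡1+∣p∣ zero    (inside  ∷ p) x∉p = ⊥-elim (x∉p here)
∣⁅x⁆∪p∣≡1+∣p∣ (suc x) (outside ∷ p) x∉p = ∣⁅x⁆∪p∣≡1+∣p∣ x p (x∉p ∘ there)
∣⁅x⁆∪p∣≡1+∣p∣ (suc x) (inside  ∷ p) x∉p = cong suc (∣⁅x⁆∪p∣≡1+∣p∣ x p (x∉p ∘ there))

∣image∣ : ∀ {n m} {φ : Fin n → Fin m} → Injective _≡_ _≡_ φ → ∀ s → ∣ image φ s ∣ ≡ ∣ s ∣
∣image∣ {m = m} φ-inj [] = ∣⊥∣≡0 m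
∣image∣ φ-inj (outside ∷ s) = ∣image∣ (suc-injective ∘ φ-inj) s
∣image∣ {φ = φ} φ-inj (inside ∷ s) =
  trans (∣⁅x⁆∪p∣≡1+∣p∣ (φ zero) _ φ0∉) (cong suc (∣image∣ (suc-injective ∘ φ-inj) s))
  where
  φ0∉ : φ zero ∉ₛ image (φ ∘ suc) s
  φ0∉ φ0∈ with ∈-image⁻ (φ ∘ suc) s φ0∈
  ... | _ , _ , φ1+x≡φ0 = 0≢1+n (φ-inj (sym φ1+x≡φ0))

=ᶠ≡false⇒≢ : ∀ {n} {i j : Fin n} → (i =ᶠ j) ≡ false → i ≢ j
=ᶠ≡false⇒≢ {i = i} eq refl with () ← trans (sym (=ᶠ-refl i)) eq

IsClique : ∀ {N} → Graph N → Subset N → Set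
IsClique H s = ∀ {i j} → i ∈ₛ s → j ∈ₛ s → i ≢ j → adj H i j ≡ true

module _ {A : Set} (p : A → Bool) where

  allB⇒ : ∀ {xs} → allB p xs ≡ true → ∀ {x} → x ∈ xs → p x ≡ true
  allB⇒ {y ∷ _} eq (Any.here refl) with p y
  ... | true = refl
  allB⇒ {y ∷ _} eq (Any.there x∈xs) with p y
  ... | true = allB⇒ eq x∈xs

  allB⇐ : ∀ xs → (∀ {x} → x ∈ xs → p x ≡ true) → allB p xs ≡ true
  allB⇐ []       _   = refl
  allB⇐ (y ∷ xs) all rewrite all (Any.here refl) = allB⇐ xs (all ∘ Any.there)

module _ {N} (H : Graph N) (s : Subset N) where

  private
    pairTest : Fin N → Fin N → Bool
    pairTest i j = not (memb i s ∧ memb j s ∧ not (i =ᶠ j)) ∨ adj H i j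

  isClique⇒IsClique : isClique H s ≡ true → IsClique H s
  isClique⇒IsClique cl {i} {j} i∈s j∈s i≢j =
    test⇒ (memb i s) (memb j s) (i =ᶠ j) (adj H i j)
      (allB⇒ (pairTest i) (allB⇒ _ cl (∈-allFin i)) (∈-allFin j))
      ([]=⇒lookup i∈s) ([]=⇒lookup j∈s) (dec-false (i ≟ j) i≢j)
    where
    test⇒ : ∀ x y z t → (not (x ∧ y ∧ not z) ∨ t) ≡ true → x ≡ true → y ≡ true → z ≡ false → t ≡ true
    test⇒ true true false true _ _ _ _ = refl

  IsClique⇒isClique : IsClique H s → isClique H s ≡ true
  IsClique⇒isClique cl = allB⇐ _ (allFin N) λ {i} _ → allB⇐ (pairTest i) (allFin N) λ {j} _ →
    test⇐ (memb i s) (memb j s) (i =ᶠ j) (adj H i j)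
      λ i∈s j∈s i≠j → cl (lookup⇒[]= i s i∈s) (lookup⇒[]= j s j∈s) (=ᶠ≡false⇒≢ i≠j)
    where
    test⇐ : ∀ x y z t → (x ≡ true → y ≡ true → z ≡ false → t ≡ true) → (not (x ∧ y ∧ not z) ∨ t) ≡ true
    test⇐ false _     _     _     _ = refl
    test⇐ true  false _     _     _ = refl
    test⇐ true  true  true  _     _ = refl
    test⇐ true  true  false true  _ = refl
    test⇐ true  true  false false h = h refl refl refl

subsets-unique : ∀ N → Unique (subsets N)
subsets-unique zero    = All.[] ∷ []
subsets-unique (suc N) =
  Unique.++⁺ (Unique.map⁺ ∷-injectiveʳ (subsets-unique N)) (Unique.map⁺ ∷-injectiveʳ (subsets-unique N))
    λ (s∈false∷ , s∈true∷) → head-differs (∈-map⁻ (false ∷_) s∈false∷) (∈-map⁻ (true ∷_) s∈true∷)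
  where
  ∷-injectiveʳ : ∀ {x} {s t : Subset N} → (Subset (suc N) ∋ x ∷ s) ≡ x ∷ t → s ≡ t
  ∷-injectiveʳ refl = refl
  head-differs : ∀ {u : Subset (suc N)} → ∃[ s ] s ∈ subsets N × u ≡ false ∷ s
    → ∃[ t ] t ∈ subsets N × u ≡ true ∷ t → ⊥
  head-differs (_ , _ , refl) (_ , _ , ())

∈-subsets : ∀ {N} (s : Subset N) → s ∈ subsets N
∈-subsets []                    = Any.here refl
∈-subsets {suc N} (outside ∷ s) = ∈-++⁺ˡ (∈-map⁺ (outside ∷_) (∈-subsets s))
∈-subsets {suc N} (inside  ∷ s) = ∈-++⁺ʳ (map (outside ∷_) (subsets N)) (∈-map⁺ (inside ∷_) (∈-subsets s))

cliqueList : ℕ → ∀ {N} → Graph N → List (Subset N)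
cliqueList k {N} H = filter (λ s → ∣ s ∣ ≟ℕ k) (filter (λ s → isClique H s ≟𝔹 true) (subsets N))

cliqueList-unique : ∀ k {N} (H : Graph N) → Unique (cliqueList k H)
cliqueList-unique k {N} H = Unique.filter⁺ _ (Unique.filter⁺ _ (subsets-unique N))

∈-cliqueList⁻ : ∀ {k N} {H : Graph N} {s} → s ∈ cliqueList k H → IsClique H s × ∣ s ∣ ≡ k
∈-cliqueList⁻ {k} {N} {H} s∈ with ∈-filter⁻ (λ s → ∣ s ∣ ≟ℕ k) {xs = filter _ (subsets N)} s∈
... | s∈′ , ∣s∣≡k with ∈-filter⁻ (λ s → isClique H s ≟𝔹 true) {xs = subsets N} s∈′
...   | _ , cl = isClique⇒IsClique H _ cl , ∣s∣≡k

∈-cliqueList⁺ : ∀ {k N} {H : Graph N} {s} → IsClique H s → ∣ s ∣ ≡ k → s ∈ cliqueList k H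
∈-cliqueList⁺ {k} {H = H} {s} cl ∣s∣≡k = ∈-filter⁺ (λ s → ∣ s ∣ ≟ℕ k)
  (∈-filter⁺ (λ s → isClique H s ≟𝔹 true) (∈-subsets s) (IsClique⇒isClique H s cl)) ∣s∣≡k

image-IsClique : ∀ {N M} {H : Graph N} {H′ : Graph M} {φ : Fin N → Fin M}
  → (∀ {x y} → adj H x y ≡ true → adj H′ (φ x) (φ y) ≡ true)
  → ∀ {s} → IsClique H s → IsClique H′ (image φ s)
image-IsClique {φ = φ} hom {s} cl y₁∈ y₂∈ y₁≢y₂ with ∈-image⁻ φ s y₁∈ | ∈-image⁻ φ s y₂∈
... | x₁ , x₁∈s , refl | x₂ , x₂∈s , refl = hom (cl x₁∈s x₂∈s λ x₁≡x₂ → y₁≢y₂ (cong φ x₁≡x₂))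

π-mono : ∀ k {N M} (H : Graph N) (H′ : Graph M) (φ : Fin N → Fin M) → Injective _≡_ _≡_ φ
  → (∀ {x y} → adj H x y ≡ true → adj H′ (φ x) (φ y) ≡ true) → π k H ≤ π k H′
π-mono k H H′ φ φ-inj hom = length-≤-injection {xs = cliqueList k H} {ys = cliqueList k H′}
  (cliqueList-unique k H) (image-injective φ-inj) image-cliqueList
  where
  image-cliqueList : ∀ {s} → s ∈ cliqueList k H → image φ s ∈ cliqueList k H′
  image-cliqueList {s} s∈ with ∈-cliqueList⁻ {k} {H = H} s∈
  ... | cl , ∣s∣≡k = ∈-cliqueList⁺ {H = H′} (image-IsClique {H = H} {H′} hom cl) (trans (∣image∣ φ-inj s) ∣s∣≡k)

Occupied : ∀ {n} → (Fin n → ℕ) → Fin n × ℕ → Set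
Occupied w (v , j) = j < w v

module _ {n} (w : Fin n → ℕ) where

  private
    block : Fin n → List (Fin n × ℕ)
    block v = map (v ,_) (upTo (w v))

  vertexOf : Fin (length (blowVerts w)) → Fin n
  vertexOf x = proj₁ (lookup (blowVerts w) x)

  ∈-blowVerts⁺ : ∀ {x} → Occupied w x → x ∈ blowVerts w
  ∈-blowVerts⁺ {v , _} j<wv = ∈-concat⁺′ (∈-map⁺ (v ,_) (∈-upTo⁺ j<wv)) (∈-map⁺ block (∈-allFin v))

  ∈-blowVerts⁻ : ∀ {x} → x ∈ blowVerts w → Occupied w x
  ∈-blowVerts⁻ x∈ with ∈-concat⁻′ (map block (allFin n)) x∈
  ... | _ , x∈block , block∈ with ∈-map⁻ block block∈
  ... | v , _ , refl with ∈-map⁻ (v ,_) x∈block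
  ... | _ , j∈ , refl = ∈-upTo⁻ j∈

  blowVerts-unique : Unique (blowVerts w)
  blowVerts-unique = Unique.concat⁺ (All.tabulate block-unique)
    (AllPairs.map⁺ (AllPairs.map blocks-disjoint (Unique.allFin⁺ n)))
    where
    block-unique : ∀ {xs} → xs ∈ map block (allFin n) → Unique xs
    block-unique xs∈ with ∈-map⁻ block xs∈
    ... | v , _ , refl = Unique.map⁺ (cong proj₂) (Unique.upTo⁺ (w v))
    blocks-disjoint : ∀ {u v} → u ≢ v → ∀ {x} → ¬ (x ∈ block u × x ∈ block v)
    blocks-disjoint u≢v (x∈u , x∈v) with ∈-map⁻ _ x∈u | ∈-map⁻ _ x∈v
    ... | _ , _ , refl | _ , _ , refl = u≢v refl

SameOrAdj : ∀ {n} → Graph n → Fin n → Fin n → Set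
SameOrAdj G u v = u ≡ v ⊎ adj G u v ≡ true

SameOrAdj-sym : ∀ {n} (G : Graph n) {u v} → SameOrAdj G u v → SameOrAdj G v u
SameOrAdj-sym G (inj₁ u≡v) = inj₁ (sym u≡v)
SameOrAdj-sym G {u} {v} (inj₂ uv) = inj₂ (trans (symm G v u) uv)

module _ {n} (G : Graph n) (w : Fin n → ℕ) where

  adj-blowup⇒ : ∀ {x y} → adj (blowup G w) x y ≡ true → x ≢ y × SameOrAdj G (vertexOf w x) (vertexOf w y)
  adj-blowup⇒ {x} {y} xy with x ≟ y | vertexOf w x ≟ vertexOf w y
  ... | no x≢y | yes u≡v = x≢y , inj₁ u≡v
  ... | no x≢y | no _    = x≢y , inj₂ xy

  adj-blowup⇐ : ∀ {x y} → x ≢ y → SameOrAdj G (vertexOf w x) (vertexOf w y) → adj (blowup G w) x y ≡ true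
  adj-blowup⇐ {x} {y} x≢y uv with x ≟ y | vertexOf w x ≟ vertexOf w y
  ... | yes x≡y | _       = contradiction x≡y x≢y
  ... | no _    | yes _   = refl
  ... | no _    | no u≢v  with uv
  ...   | inj₁ u≡v = contradiction u≡v u≢v
  ...   | inj₂ adj-uv = adj-uv

record BlowupEmbedding {n n′} (G : Graph n) (w : Fin n → ℕ) (G′ : Graph n′) (w′ : Fin n′ → ℕ) : Set where
  field
    embed     : Fin n × ℕ → Fin n′ × ℕ
    occupied  : ∀ {x} → Occupied w x → Occupied w′ (embed x)
    injective : ∀ {x y} → Occupied w x → Occupied w y → embed x ≡ embed y → x ≡ y
    preserves : ∀ {x y} → Occupied w x → Occupied w y
      → SameOrAdj G (proj₁ x) (proj₁ y) → SameOrAdj G′ (proj₁ (embed x)) (proj₁ (embed y))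

π-blowup-mono : ∀ {n n′} {G : Graph n} {w : Fin n → ℕ} {G′ : Graph n′} {w′ : Fin n′ → ℕ}
  → BlowupEmbedding G w G′ w′ → ∀ k → π k (blowup G w) ≤ π k (blowup G′ w′)
π-blowup-mono {G = G} {w} {G′} {w′} e k = π-mono k (blowup G w) (blowup G′ w′) φ φ-injective φ-hom
  where
  open BlowupEmbedding e

  occupied-lookup : ∀ x → Occupied w (lookup (blowVerts w) x)
  occupied-lookup x = ∈-blowVerts⁻ w (∈-lookup x)

  embed∈ : ∀ x → embed (lookup (blowVerts w) x) ∈ blowVerts w′
  embed∈ x = ∈-blowVerts⁺ w′ (occupied (occupied-lookup x))

  φ : Fin (length (blowVerts w)) → Fin (length (blowVerts w′))
  φ x = Any.index (embed∈ x)

  φ-injective : Injective _≡_ _≡_ φ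
  φ-injective {x} {y} φx≡φy = lookup-injective (blowVerts-unique w)
    (injective {lookup (blowVerts w) x} {lookup (blowVerts w) y} (occupied-lookup x) (occupied-lookup y)
      (index-injective (embed∈ x) (embed∈ y) φx≡φy))

  vertexOf-φ : ∀ x → vertexOf w′ (φ x) ≡ proj₁ (embed (lookup (blowVerts w) x))
  vertexOf-φ x = cong proj₁ (sym (lookup-index (embed∈ x)))

  φ-hom : ∀ {x y} → adj (blowup G w) x y ≡ true → adj (blowup G′ w′) (φ x) (φ y) ≡ true
  φ-hom {x} {y} xy with adj-blowup⇒ G w xy
  ... | x≢y , uv = adj-blowup⇐ G′ w′ (x≢y ∘ φ-injective)
    (subst₂ (SameOrAdj G′) (sym (vertexOf-φ x)) (sym (vertexOf-φ y))
      (preserves (occupied-lookup x) (occupied-lookup y) uv))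

findIdx-just : ∀ {r n} {f : Fin r → Fin n} {v i} → findIdx f v ≡ just i → f i ≡ v
findIdx-just {zero} ()
findIdx-just {suc r} {f = f} {v} eq with f zero ≟ v
findIdx-just {suc r} refl | yes f0≡v = f0≡v
... | no _ with findIdx (f ∘ suc) v in eq′
findIdx-just {suc r} refl | no _ | just i = findIdx-just eq′

findIdx-nothing : ∀ {r n} {f : Fin r → Fin n} {v} → findIdx f v ≡ nothing → ∀ i → f i ≢ v
findIdx-nothing {suc r} {f = f} {v} eq i with f zero ≟ v
findIdx-nothing {suc r} () i | yes _
... | no f0≢v with findIdx (f ∘ suc) v in eq′
findIdx-nothing {suc r} () i | no _ | just _
findIdx-nothing {suc r} refl zero    | no f0≢v | nothing = f0≢v
findIdx-nothing {suc r} refl (suc i) | no _    | nothing = findIdx-nothing eq′ i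

findIdx-self : ∀ {r n} {f : Fin r → Fin n} → Injective _≡_ _≡_ f → ∀ i → findIdx f (f i) ≡ just i
findIdx-self {f = f} f-inj i with findIdx f (f i) in eq
... | just j  = cong just (f-inj (findIdx-just eq))
... | nothing = contradiction refl (findIdx-nothing eq i)

data Position {r n} (a b : Fin r → Fin n) : Fin n → Set where
  inA       : ∀ i → Position a b (a i)
  inB       : ∀ i → Position a b (b i)
  elsewhere : ∀ {v} → (∀ i → v ≢ a i) → (∀ i → v ≢ b i) → Position a b v

position : ∀ {r n} (a b : Fin r → Fin n) v → Position a b v
position a b v with findIdx a v in eqᵃ | findIdx b v in eqᵇ
... | just i  | _       = subst (Position a b) (findIdx-just eqᵃ) (inA i)
... | nothing | just i  = subst (Position a b) (findIdx-just eqᵇ) (inB i)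
... | nothing | nothing =
  elsewhere (λ i → findIdx-nothing eqᵃ i ∘ sym) (λ i → findIdx-nothing eqᵇ i ∘ sym)

module _ {r n} {a b : Fin r → Fin n} (w : Fin n → ℕ) where

  shift-inA : Injective _≡_ _≡_ a → ∀ i → shift a b w (a i) ≡ 0
  shift-inA a-inj i rewrite findIdx-self a-inj i = refl

  shift-inB : (∀ i j → a i ≢ b j) → Injective _≡_ _≡_ b → ∀ i → shift a b w (b i) ≡ w (b i) + w (a i)
  shift-inB a≢b b-inj i with findIdx a (b i) in eq
  ... | just j  = contradiction (findIdx-just eq) (a≢b j i)
  ... | nothing rewrite findIdx-self b-inj i = refl

  shift-elsewhere : ∀ {v} → (∀ i → v ≢ a i) → (∀ i → v ≢ b i) → shift a b w v ≡ w v
  shift-elsewhere {v} v≢a v≢b with findIdx a v in eqᵃ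
  ... | just i  = contradiction (sym (findIdx-just eqᵃ)) (v≢a i)
  ... | nothing with findIdx b v in eqᵇ
  ...   | just i  = contradiction (sym (findIdx-just eqᵇ)) (v≢b i)
  ...   | nothing = refl

splitBlock : ∀ {n} → Fin n → Fin n → ℕ → ℕ → Fin n × ℕ
splitBlock x y c j with j <? c
... | yes _ = x , j
... | no  _ = y , j ∸ c

module _ {n} {x y : Fin n} where

  splitBlock-vertex : ∀ c j → proj₁ (splitBlock x y c j) ≡ x ⊎ proj₁ (splitBlock x y c j) ≡ y
  splitBlock-vertex c j with j <? c
  ... | yes _ = inj₁ refl
  ... | no  _ = inj₂ refl

  splitBlock-occupied : ∀ (w : Fin n → ℕ) {j} → j < w y + w x → Occupied w (splitBlock x y (w x) j)
  splitBlock-occupied w {j} j<wy+wx with j <? w x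
  ... | yes j<wx = j<wx
  ... | no  j≮wx = subst (j ∸ w x <_) (m+n∸n≡m (w y) (w x)) (∸-monoˡ-< j<wy+wx (≮⇒≥ j≮wx))

  splitBlock-injective : x ≢ y → ∀ {c j l} → splitBlock x y c j ≡ splitBlock x y c l → j ≡ l
  splitBlock-injective x≢y {c} {j} {l} eq with j <? c | l <? c
  ... | yes _   | yes _   = proj₂ (,-injective eq)
  ... | yes _   | no _    = contradiction (proj₁ (,-injective eq)) x≢y
  ... | no _    | yes _   = contradiction (sym (proj₁ (,-injective eq))) x≢y
  ... | no j≮c  | no l≮c  = begin
    j             ≡⟨ m∸n+n≡m (≮⇒≥ j≮c) ⟨
    j ∸ c + c     ≡⟨ cong (_+ c) (proj₂ (,-injective eq)) ⟩
    l ∸ c + c     ≡⟨ m∸n+n≡m (≮⇒≥ l≮c) ⟩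
    l             ∎
    where open ≡-Reasoning

module ShiftEmbedding {r n} (G : Graph n) (w : Fin n → ℕ) (a b : Fin r → Fin n)
  (a-inj : Injective _≡_ _≡_ a) (b-inj : Injective _≡_ _≡_ b) (a≢b : ∀ i j → a i ≢ b j)
  (adj-ab : ∀ i → adj G (a i) (b i) ≡ true)
  (b-independent : ∀ i j → adj G (b i) (b j) ≡ false)
  (b-dominated : ∀ i v → adj G (b i) v ≡ true → (∀ j → v ≢ a j) → w v ≢ 0 → adj G (a i) v ≡ true)
  where

  private
    w′ : Fin n → ℕ
    w′ = shift a b w

    InPair : Fin r → Fin n → Set
    InPair i v = v ≡ a i ⊎ v ≡ b i

  unshift : Fin n × ℕ → Fin n × ℕ
  unshift (v , j) with position a b v
  ... | inB i = splitBlock (a i) (b i) (w (a i)) j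
  ... | _     = v , j

  private
    inPair-injective : ∀ {i i′ v} → InPair i v → InPair i′ v → i ≡ i′
    inPair-injective          (inj₁ refl) (inj₁ ai≡ai′) = a-inj ai≡ai′
    inPair-injective {i} {i′} (inj₁ refl) (inj₂ ai≡bi′) = contradiction ai≡bi′ (a≢b i i′)
    inPair-injective {i} {i′} (inj₂ refl) (inj₁ bi≡ai′) = contradiction (sym bi≡ai′) (a≢b i′ i)
    inPair-injective          (inj₂ refl) (inj₂ bi≡bi′) = b-inj bi≡bi′

    inPair-SameOrAdj : ∀ {i u v} → InPair i u → InPair i v → SameOrAdj G u v
    inPair-SameOrAdj     (inj₁ refl) (inj₁ refl) = inj₁ refl
    inPair-SameOrAdj     (inj₂ refl) (inj₂ refl) = inj₁ refl
    inPair-SameOrAdj {i} (inj₁ refl) (inj₂ refl) = inj₂ (adj-ab i)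
    inPair-SameOrAdj {i} (inj₂ refl) (inj₁ refl) = SameOrAdj-sym G (inj₂ (adj-ab i))

    unshift-inB : ∀ i j → InPair i (proj₁ (splitBlock (a i) (b i) (w (a i)) j))
    unshift-inB i j = splitBlock-vertex (w (a i)) j

    unoccupied-inA : ∀ i {j} → ¬ Occupied w′ (a i , j)
    unoccupied-inA i {j} j<w′ai = n≮0 (subst (j <_) (shift-inA w a-inj i) j<w′ai)

    elsewhere⇒¬InPair : ∀ {i v} → (∀ i → v ≢ a i) → (∀ i → v ≢ b i) → ¬ InPair i v
    elsewhere⇒¬InPair {i} v≢a v≢b (inj₁ v≡ai) = v≢a i v≡ai
    elsewhere⇒¬InPair {i} v≢a v≢b (inj₂ v≡bi) = v≢b i v≡bi

    towards-elsewhere : ∀ i {u v l} → (∀ i → v ≢ a i) → (∀ i → v ≢ b i) → Occupied w′ (v , l)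
      → SameOrAdj G (b i) v → InPair i u → SameOrAdj G u v
    towards-elsewhere i v≢a v≢b _ (inj₁ bi≡v) _ = contradiction (sym bi≡v) (v≢b i)
    towards-elsewhere i v≢a v≢b _ (inj₂ bi~v) (inj₂ refl) = inj₂ bi~v
    towards-elsewhere i {v = v} {l} v≢a v≢b l<w′v (inj₂ bi~v) (inj₁ refl) =
      inj₂ (b-dominated i v bi~v v≢a (m<n⇒n≢0 (subst (l <_) (shift-elsewhere w v≢a v≢b) l<w′v)))

  unshift-occupied : ∀ {x} → Occupied w′ x → Occupied w (unshift x)
  unshift-occupied {v , j} j<w′v with position a b v
  ... | inA i             = contradiction j<w′v (unoccupied-inA i)
  ... | inB i             = splitBlock-occupied w (subst (j <_) (shift-inB w a≢b b-inj i) j<w′v)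
  ... | elsewhere v≢a v≢b = subst (j <_) (shift-elsewhere w v≢a v≢b) j<w′v

  unshift-injective : ∀ {x y} → Occupied w′ x → Occupied w′ y → unshift x ≡ unshift y → x ≡ y
  unshift-injective {u , j} {v , l} j<w′u l<w′v eq with position a b u | position a b v
  ... | inA i | _     = contradiction j<w′u (unoccupied-inA i)
  ... | _     | inA i = contradiction l<w′v (unoccupied-inA i)
  ... | inB i | inB i′
    with inPair-injective (unshift-inB i j) (subst (InPair i′) (sym (cong proj₁ eq)) (unshift-inB i′ l))
  ...   | refl = cong (b i ,_) (splitBlock-injective (a≢b i i) eq)
  unshift-injective _ _ eq | inB i | elsewhere v≢a v≢b =
    contradiction (subst (InPair i) (cong proj₁ eq) (unshift-inB i _)) (elsewhere⇒¬InPair v≢a v≢b)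
  unshift-injective _ _ eq | elsewhere u≢a u≢b | inB i =
    contradiction (subst (InPair i) (sym (cong proj₁ eq)) (unshift-inB i _)) (elsewhere⇒¬InPair u≢a u≢b)
  unshift-injective _ _ eq | elsewhere _ _ | elsewhere _ _ = eq

  unshift-preserves : ∀ {x y} → Occupied w′ x → Occupied w′ y
    → SameOrAdj G (proj₁ x) (proj₁ y) → SameOrAdj G (proj₁ (unshift x)) (proj₁ (unshift y))
  unshift-preserves {u , j} {v , l} j<w′u l<w′v u~v with position a b u | position a b v
  ... | inA i | _     = contradiction j<w′u (unoccupied-inA i)
  ... | _     | inA i = contradiction l<w′v (unoccupied-inA i)
  ... | inB i | inB i′ with u~v
  ...   | inj₂ bi~bi′ = contradiction (trans (sym bi~bi′) (b-independent i i′)) λ ()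
  ...   | inj₁ bi≡bi′ with b-inj bi≡bi′
  ...     | refl = inPair-SameOrAdj (unshift-inB i j) (unshift-inB i l)
  unshift-preserves {u , j} {v , l} _ l<w′v u~v | inB i | elsewhere v≢a v≢b =
    towards-elsewhere i v≢a v≢b l<w′v u~v (unshift-inB i j)
  unshift-preserves {u , j} {v , l} j<w′u _ u~v | elsewhere u≢a u≢b | inB i =
    SameOrAdj-sym G (towards-elsewhere i u≢a u≢b j<w′u (SameOrAdj-sym G u~v) (unshift-inB i l))
  unshift-preserves _ _ u~v | elsewhere _ _ | elsewhere _ _ = u~v

  embedding : BlowupEmbedding G (shift a b w) G w
  embedding = record
    { embed     = unshift
    ; occupied  = unshift-occupied
    ; injective = unshift-injective
    ; preserves = unshift-preserves
    }

lemma3 : (m k n r : ℕ) → m ≥ 1 → k ≥ 2 → (G : Graph n) → (w : Fin n → ℕ) → wsum w ≡ m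
    → (a b : Fin r → Fin n) → Injective _≡_ _≡_ a → Injective _≡_ _≡_ b
    → (∀ i j → a i ≢ b j)
    → (∀ i → adj G (a i) (b i) ≡ true)
    → (∀ i j → adj G (b i) (b j) ≡ false)
    → (∀ i v → adj G (b i) v ≡ true → (∀ j → v ≢ a j) → w v ≢ 0 → adj G (a i) v ≡ true)
    → π k (blowup G (shift a b w)) ≤ π k (blowup G w)
lemma3 _ k _ _ _ _ G w _ a b a-inj b-inj a≢b adj-ab b-independent b-dominated =
  π-blowup-mono (ShiftEmbedding.embedding G w a b a-inj b-inj a≢b adj-ab b-independent b-dominated) k
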